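{- Let $\Phi$ be an axiom environment, $A$ an atomic formula and $e$ an evidence term. Then $\Phi \vdash A \Downarrow e$ if and only if $\Phi \vdash A \to^* e$.
   Context: Terms are first-order applicative terms $t ::= x \mid K \mid t\,t'$ ($x$ a variable, $K$ a constant symbol). Atomic formulas are $A ::= P\,t_1 \cdots t_n$ for predicate symbols $P$. A Horn formula is $B_1,\dots,B_n \Rightarrow A$ with $B_i, A$ atomic, all variables implicitly universally quantified, and $\bigcup_i \mathrm{FV}(B_i) \subseteq \mathrm{FV}(A)$ (no existential variables); $n=0$ is allowed. Evidence terms are $e ::= \kappa \mid e\,e'$ where $\kappa$ ranges over evidence constants. An axiom environment $\Phi$ is a finite set of Horn formulas labelled with pairwise distinct evidence constants, written $(\kappa : H)$. A substitution $\sigma$ maps variables to terms. Resolution judgement $\Phi \vdash A \Downarrow e$ is defined inductively by the single rule: if $(\kappa : B_1,\dots,B_n \Rightarrow A) \in \Phi$, $\sigma$ is a substitution, and $\Phi \vdash \sigma B_i \Downarrow e_i$ for all $i=1,\dots,n$, then $\Phi \vdash \sigma A \Downarrow \kappa\, e_1 \cdots e_n$. Mixed terms are $q ::= A \mid \kappa \mid q\,q'$ ($A$ atomic formula); mixed term contexts are $\mathcal{C} ::= \bullet \mid \mathcal{C}\,q \mid q\,\mathcal{C}$, and $\mathcal{C}[q]$ denotes replacing the hole $\bullet$ by $q$. Small-step resolution: if $(\kappa : B_1,\dots,B_n \Rightarrow A) \in \Phi$ and $\sigma$ is a substitution, then $\Phi \vdash \mathcal{C}[\sigma A] \to \mathcal{C}[\kappa\,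 \sigma B_1 \cdots \sigma B_n]$ for any context $\mathcal{C}$. $\Phi \vdash q \to^* q'$ denotes the reflexive–transitive closure of $\to$. -}

module Defs where

open import Data.Nat using (ℕ)
open import Data.List using (List; []; _∷_; map; foldl)
open import Data.List.Membership.Propositional using (_∈_)
open import Data.List.Relation.Unary.All using (All)
open import Data.List.Relation.Unary.Any using (Any)
open import Data.List.Relation.Unary.Unique.Propositional using (Unique)
open import Data.Product using (_×_; _,_; proj₁; proj₂; Σ)
open import Relation.Binary.PropositionalEquality using (_≡_)
open import Relation.Binary.Construct.Closure.ReflexiveTransitive using (Star)

module Resolution (Con Pred EvC : Set) where

  data Term : Set where
    var   : ℕ → Term
    const : Con → Term
    app   : Term → Term → Term

  record Atom : Set where
    constructor atom
    field
      pred : Pred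
      args : List Term
  open Atom public

  data _∈FVt_ (x : ℕ) : Term → Set where
    here : x ∈FVt var x
    appˡ : ∀ {t u} → x ∈FVt t → x ∈FVt app t u
    appʳ : ∀ {t u} → x ∈FVt u → x ∈FVt app t u

  _∈FV_ : ℕ → Atom → Set
  x ∈FV A = Any (x ∈FVt_) (args A)

  record Horn : Set where
    constructor _⇒_∣_
    field
      body : List Atom
      head : Atom
      noExist : All (λ B → ∀ x → x ∈FV B → x ∈FV head) body
  open Horn public

  record Env : Set where
    field
      axioms   : List (EvC × Horn)
      distinct : Unique (map proj₁ axioms)
  open Env public

  Subst : Set
  Subst = ℕ → Term

  substT : Subst → Term → Term
  substT σ (var x)   = σ x
  substT σ (const k) = const k
  substT σ (app t u) = app (substT σ t) (substT σ u)

  substA : Subst → Atom → Atom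
  substA σ (atom P ts) = atom P (map (substT σ) ts)

  data Ev : Set where
    evc  : EvC → Ev
    evap : Ev → Ev → Ev

  evApps : Ev → List Ev → Ev
  evApps = foldl evap

  data _⊢_⇓_ (Φ : Env) : Atom → Ev → Set
  data Pointwise (Φ : Env) (σ : Subst) : List Atom → List Ev → Set

  data _⊢_⇓_ Φ where
    res : ∀ {κ H} (σ : Subst) → (κ , H) ∈ axioms Φ →
          (es : List Ev) → Pointwise Φ σ (body H) es →
          Φ ⊢ substA σ (head H) ⇓ evApps (evc κ) es

  data Pointwise Φ σ where
    []  : Pointwise Φ σ [] []
    _∷_ : ∀ {B Bs e es} → Φ ⊢ substA σ B ⇓ e → Pointwise Φ σ Bs es →
          Pointwise Φ σ (B ∷ Bs) (e ∷ es)

  data Mixed : Set where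
    at  : Atom → Mixed
    mc  : EvC → Mixed
    mapp : Mixed → Mixed → Mixed

  mApps : Mixed → List Mixed → Mixed
  mApps = foldl mapp

  data Ctx : Set where
    ∙   : Ctx
    _·ˡ_ : Ctx → Mixed → Ctx
    _·ʳ_ : Mixed → Ctx → Ctx

  plug : Ctx → Mixed → Mixed
  plug ∙ q        = q
  plug (C ·ˡ q') q = mapp (plug C q) q'
  plug (q' ·ʳ C) q = mapp q' (plug C q)

  data _⊢_⟶_ (Φ : Env) : Mixed → Mixed → Set where
    step : ∀ {κ H} (C : Ctx) (σ : Subst) → (κ , H) ∈ axioms Φ →
           Φ ⊢ plug C (at (substA σ (head H)))
             ⟶ plug C (mApps (mc κ) (map (λ B → at (substA σ B)) (body H)))

  _⊢_⟶*_ : Env → Mixed → Mixed → Set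
  Φ ⊢ q ⟶* q' = Star (Φ ⊢_⟶_) q q'

  ⌜_⌝ : Ev → Mixed
  ⌜ evc κ ⌝    = mc κ
  ⌜ evap e e' ⌝ = mapp ⌜ e ⌝ ⌜ e' ⌝

-- Forward: replay a derivation tree as a left-to-right sequence of steps, one
-- per node.  Backward: extend ⇓ to mixed terms congruently (an embedded atom
-- resolves as before, constants and applications structurally).  An evidence
-- term resolves to itself, and resolution is preserved by backward steps: the
-- spine κ σB₁ ⋯ σBₙ introduced by a step resolves only to κ e₁ ⋯ eₙ with each
-- σBᵢ ⇓ eᵢ, which is exactly a premise of the rule resolving σA.
module Submission where

open import Defs
open import Function.Bundles using (_⇔_; mk⇔)
open import Data.List using (List; []; _∷_; map)
open import Data.Product using (∃₂; _×_; _,_)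
open import Relation.Binary.PropositionalEquality using (_≡_; refl)
open import Relation.Binary.Construct.Closure.ReflexiveTransitive using (ε; _◅_; _◅◅_; gmap)

module ResolutionEquivalence (Con Pred EvC : Set) (Φ : Resolution.Env Con Pred EvC) where
  open Resolution Con Pred EvC

  instances : Subst → List Atom → List Mixed
  instances σ = map (λ B → at (substA σ B))

  mapp-congˡ-⟶* : ∀ {q q'} r → Φ ⊢ q ⟶* q' → Φ ⊢ mapp q r ⟶* mapp q' r
  mapp-congˡ-⟶* r = gmap (λ q → mapp q r) λ { (step C σ κ∈Φ) → step (C ·ˡ r) σ κ∈Φ }

  mapp-congʳ-⟶* : ∀ {q q'} r → Φ ⊢ q ⟶* q' → Φ ⊢ mapp r q ⟶* mapp r q'
  mapp-congʳ-⟶* r = gmap (mapp r) λ { (step C σ κ∈Φ) → step (r ·ʳ C) σ κ∈Φ }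

  ⇓⇒⟶* : ∀ {A e} → Φ ⊢ A ⇓ e → Φ ⊢ at A ⟶* ⌜ e ⌝
  mApps-instances-⟶* : ∀ {σ Bs es} h eₕ → Φ ⊢ h ⟶* ⌜ eₕ ⌝ → Pointwise Φ σ Bs es →
                       Φ ⊢ mApps h (instances σ Bs) ⟶* ⌜ evApps eₕ es ⌝

  ⇓⇒⟶* (res {κ} σ κ∈Φ es premises) =
    step ∙ σ κ∈Φ ◅ mApps-instances-⟶* (mc κ) (evc κ) ε premises

  mApps-instances-⟶* h eₕ h⟶* [] = h⟶*
  mApps-instances-⟶* {σ} h eₕ h⟶* (_∷_ {B} {e = e} B⇓e premises) =
    mApps-instances-⟶* (mapp h (at (substA σ B))) (evap eₕ e)
      (mapp-congˡ-⟶* _ h⟶* ◅◅ mapp-congʳ-⟶* ⌜ eₕ ⌝ (⇓⇒⟶* B⇓e)) premises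

  data _⇓ᵐ_ : Mixed → Ev → Set where
    at   : ∀ {A e} → Φ ⊢ A ⇓ e → at A ⇓ᵐ e
    mc   : ∀ {κ} → mc κ ⇓ᵐ evc κ
    mapp : ∀ {q r e e'} → q ⇓ᵐ e → r ⇓ᵐ e' → mapp q r ⇓ᵐ evap e e'

  ⌜⌝-⇓ᵐ : ∀ e → ⌜ e ⌝ ⇓ᵐ e
  ⌜⌝-⇓ᵐ (evc κ)    = mc
  ⌜⌝-⇓ᵐ (evap e e') = mapp (⌜⌝-⇓ᵐ e) (⌜⌝-⇓ᵐ e')

  mApps-instances-⇓ᵐ⁻ : ∀ σ h Bs {e} → mApps h (instances σ Bs) ⇓ᵐ e →
                        ∃₂ λ eₕ es → h ⇓ᵐ eₕ × Pointwise Φ σ Bs es × e ≡ evApps eₕ es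
  mApps-instances-⇓ᵐ⁻ σ h [] h⇓e = _ , [] , h⇓e , [] , refl
  mApps-instances-⇓ᵐ⁻ σ h (B ∷ Bs) spine⇓e
    with mApps-instances-⇓ᵐ⁻ σ (mapp h (at (substA σ B))) Bs spine⇓e
  ... | _ , es , mapp h⇓eₕ (at B⇓e) , premises , e≡ = _ , _ ∷ es , h⇓eₕ , B⇓e ∷ premises , e≡

  plug-⇓ᵐ-mono : ∀ C {a b} → (∀ {e} → b ⇓ᵐ e → a ⇓ᵐ e) →
                 ∀ {e} → plug C b ⇓ᵐ e → plug C a ⇓ᵐ e
  plug-⇓ᵐ-mono ∙        b⇒a q⇓e           = b⇒a q⇓e
  plug-⇓ᵐ-mono (C ·ˡ r) b⇒a (mapp q⇓e r⇓e) = mapp (plug-⇓ᵐ-mono C b⇒a q⇓e) r⇓e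
  plug-⇓ᵐ-mono (r ·ʳ C) b⇒a (mapp r⇓e q⇓e) = mapp r⇓e (plug-⇓ᵐ-mono C b⇒a q⇓e)

  ⟶-reflects-⇓ᵐ : ∀ {q q' e} → Φ ⊢ q ⟶ q' → q' ⇓ᵐ e → q ⇓ᵐ e
  ⟶-reflects-⇓ᵐ (step {κ} {H} C σ κ∈Φ) = plug-⇓ᵐ-mono C head-redex
    where
    head-redex : ∀ {e} → mApps (mc κ) (instances σ (body H)) ⇓ᵐ e → at (substA σ (head H)) ⇓ᵐ e
    head-redex spine⇓e with mApps-instances-⇓ᵐ⁻ σ (mc κ) (body H) spine⇓e
    ... | _ , es , mc , premises , refl = at (res σ κ∈Φ es premises)

  ⟶*-reflects-⇓ᵐ : ∀ {q q' e} → Φ ⊢ q ⟶* q' → q' ⇓ᵐ e → q ⇓ᵐ e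
  ⟶*-reflects-⇓ᵐ ε        q'⇓e = q'⇓e
  ⟶*-reflects-⇓ᵐ (s ◅ ss) q'⇓e = ⟶-reflects-⇓ᵐ s (⟶*-reflects-⇓ᵐ ss q'⇓e)

  ⟶*⇒⇓ : ∀ {A e} → Φ ⊢ at A ⟶* ⌜ e ⌝ → Φ ⊢ A ⇓ e
  ⟶*⇒⇓ {e = e} A⟶*e with ⟶*-reflects-⇓ᵐ A⟶*e (⌜⌝-⇓ᵐ e)
  ... | at A⇓e = A⇓e

theorem1 : (Con Pred EvC : Set) → let open Resolution Con Pred EvC in
           (Φ : Env) (A : Atom) (e : Ev) →
           (Φ ⊢ A ⇓ e) ⇔ (Φ ⊢ at A ⟶* ⌜ e ⌝)
theorem1 Con Pred EvC Φ A e = mk⇔ ⇓⇒⟶* ⟶*⇒⇓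
  where open ResolutionEquivalence Con Pred EvC Φ
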